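{- Let $n$ be a power of two, $\alpha\in(0,1)$ with $n^{1-\alpha}$ a power of two, $\delta>0$, let $A,B$ be $n\times n$ $\delta$-bounded-difference matrices, let $R\subseteq[n]'$, and for $r\in[n]$ let $A^r,B^r$ be the $n\times n$ matrices with $A^r_{i,k}=A_{i,k}-A_{i,r}$ and $B^r_{k,j}=B_{k,j}-B_{r,j}$. For $i,j,k,r\in[n]$, if $k'\in K(i',j')$ and $r\in R\cap K(i',j')$, then $|A^r_{i,k}+B^r_{k,j}|\le 16\delta n^{1-\alpha}$.
   Context: A matrix $X$ is $\delta$-bounded-difference if for all $i,j$ (whenever the entries exist) $|X_{i,j}-X_{i,j+1}|<\delta$ and $|X_{i,j}-X_{i+1,j}|<\delta$. $[n]=\{1,\dots,n\}$. Partition $[n]$ into consecutive intervals of length $n^{1-\alpha}$; for $i\in[n]$, $i'$ is the smallest element of the interval containing $i$ (similarly $j',k'$). Let $[n]'=\{1,n^{1-\alpha}+1,\dots,n-n^{1-\alpha}+1\}$, $\tilde C_{i',j'}=\min_{k'\in[n]'}\{A_{i',k'}+B_{k',j'}\}$, and $K(i',j')=\{k'\in[n]' : A_{i',k'}+B_{k',j'}\le \tilde C_{i',j'}+8\delta n^{1-\alpha}\}$.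
   Formalization: The matrices A and B have rational entries, and δ is a positive rational. -}

module Defs where

open import Data.Nat as ℕ using (ℕ; _<_; NonZero)
open import Data.Nat.DivMod using (_/_)
open import Data.Nat.Divisibility using (_∣_; _∣?_)
open import Data.Integer using (+_)
open import Data.List using (List; foldr; map; filter; upTo)
open import Data.Product using (_×_)
open import Data.Rational as ℚ using (ℚ; _+_; _-_; _*_; _⊓_; ∣_∣)

-- Matrices are indexed 0-based: an n×n matrix is a function ℕ → ℕ → ℚ
-- of which only the entries with indices < n are relevant.
Matrix : Set
Matrix = ℕ → ℕ → ℚ

toℚ : ℕ → ℚ
toℚ m = (+ m) ℚ./ 1

BoundedDiff : ℕ → ℚ → Matrix → Set
BoundedDiff n δ X =
  (∀ i j → i < n → ℕ.suc j < n → ∣ X i j - X i (ℕ.suc j) ∣ ℚ.< δ) ×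
  (∀ i j → ℕ.suc i < n → j < n → ∣ X i j - X (ℕ.suc i) j ∣ ℚ.< δ)

-- i' : smallest element of the length-m interval containing i (0-based)
blk : (m : ℕ) → .{{_ : NonZero m}} → ℕ → ℕ
blk m i = (i / m) ℕ.* m

-- [n]' = {0, m, 2m, ..., n - m}  (0-based version)
InBlocks : ℕ → ℕ → ℕ → Set
InBlocks m n k = (k < n) × (m ∣ k)

blockList : ℕ → ℕ → List ℕ
blockList m n = filter (m ∣?_) (upTo n)

-- C̃_{i,j} = min over k' ∈ [n]' of A_{i,k'} + B_{k',j}
-- (the fold starts from the k' = 0 term, which itself lies in [n]')
Ctilde : ℕ → ℕ → Matrix → Matrix → ℕ → ℕ → ℚ
Ctilde m n A B i j =
  foldr _⊓_ (A i 0 + B 0 j) (map (λ k → A i k + B k j) (blockList m n))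

InK : ℕ → ℕ → ℚ → Matrix → Matrix → ℕ → ℕ → ℕ → Set
InK m n δ A B i j k =
  InBlocks m n k × (A i k + B k j ℚ.≤ Ctilde m n A B i j + toℚ 8 * δ * toℚ m)

Ar : Matrix → ℕ → Matrix
Ar A r i k = A i k - A i r

Br : Matrix → ℕ → Matrix
Br B r k j = B k j - B r j

{-# OPTIONS --safe #-}
module Submission where

-- With i′, j′, k′ the block representatives, set P = A i′ k′ + B k′ j′ and
-- Q = A i′ r + B r j′.  Both lie in [C̃, C̃ + 8δm], hence |P - Q| ≤ 8δm.
-- Moving one index to its block representative is a walk of fewer than m
-- unit steps, so it changes an entry by at most mδ; therefore
-- |(A i k + B k j) - P| ≤ 4mδ and |Q - (A i r + B r j)| ≤ 2mδ.  Since
-- A^r i k + B^r k j = (A i k + B k j) - (A i r + B r j), the triangle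
-- inequality gives the bound 14δm ≤ 16δm.

open import Defs
open import Data.Nat using (ℕ; _^_; _<_; NonZero)
open import Data.Product using (_×_)
open import Data.Sum using (_⊎_)
open import Relation.Binary.PropositionalEquality using (_≡_)
open import Data.Rational using (ℚ; 0ℚ; _+_; _*_; ∣_∣) renaming (_<_ to _<ℚ_; _≤_ to _≤ℚ_)

open import Data.Nat as ℕ using (suc; zero)
import Data.Nat.Properties as ℕP
open import Data.Nat.DivMod using (_%_; m≡m%n+[m/n]*n; m%n<n; m/n*n≤m)
open import Data.Nat.Divisibility using (_∣?_)
open import Data.Nat.Coprimality using (1-coprimeTo) renaming (sym to coprime-sym)
open import Data.Integer as ℤ using (+_)
import Data.Integer.Properties as ℤP
open import Data.Rational using (mkℚ; 1ℚ; -_; _-_; _⊓_; toℚᵘ; *≤*; nonNegative)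
import Data.Rational.Properties as ℚP
import Data.Rational.Unnormalised as ℚᵘ
import Data.Rational.Unnormalised.Properties as ℚᵘP
open import Data.Rational.Solver using (module +-*-Solver)
open +-*-Solver
open import Data.Product using (_,_; proj₁; proj₂)
open import Data.Sum using (inj₁; inj₂)
open import Data.List using (_∷_; foldr; map)
open import Data.List.Relation.Unary.Any using (here; there)
open import Data.List.Membership.Propositional using (_∈_)
open import Data.List.Membership.Propositional.Properties using (∈-filter⁺; ∈-upTo⁺)
open import Relation.Binary.PropositionalEquality using (refl; sym; trans; cong; subst)

toℚ≡mkℚ : ∀ a → toℚ a ≡ mkℚ (+ a) 0 (coprime-sym (1-coprimeTo a))
toℚ≡mkℚ a = ℚP.normalize-coprime (coprime-sym (1-coprimeTo a))

toℚ-suc : ∀ a → toℚ (suc a) ≡ 1ℚ + toℚ a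
toℚ-suc a = ℚP.toℚᵘ-injective
  (ℚᵘP.≃-trans unnormalised (ℚᵘP.≃-sym (ℚP.toℚᵘ-homo-+ 1ℚ (toℚ a))))
  where
  unnormalised : toℚᵘ (toℚ (suc a)) ℚᵘ.≃ toℚᵘ 1ℚ ℚᵘ.+ toℚᵘ (toℚ a)
  unnormalised rewrite toℚ≡mkℚ a | toℚ≡mkℚ (suc a) | ℕP.*-identityʳ a | ℤP.+◃n≡+n a =
    ℚᵘ.*≡* refl

toℚ-mono-≤ : ∀ {a b} → a ℕ.≤ b → toℚ a ≤ℚ toℚ b
toℚ-mono-≤ {a} {b} a≤b rewrite toℚ≡mkℚ a | toℚ≡mkℚ b =
  *≤* (ℤP.*-monoʳ-≤-nonNeg (+ 1) (ℤ.+≤+ a≤b))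

p≤q∧-p≤q⇒∣p∣≤q : ∀ {p q} → p ≤ℚ q → - p ≤ℚ q → ∣ p ∣ ≤ℚ q
p≤q∧-p≤q⇒∣p∣≤q {p} {q} p≤q -p≤q with ℚP.∣p∣≡p∨∣p∣≡-p p
... | inj₁ ∣p∣≡p  = subst (_≤ℚ q) (sym ∣p∣≡p) p≤q
... | inj₂ ∣p∣≡-p = subst (_≤ℚ q) (sym ∣p∣≡-p) -p≤q

p-q≡-[q-p] : ∀ p q → p - q ≡ - (q - p)
p-q≡-[q-p] = solve 2 (λ p q → p :- q := :- (q :- p)) refl

[p+q]-[r+s]≡[p-r]+[q-s] : ∀ p q r s → (p + q) - (r + s) ≡ (p - r) + (q - s)
[p+q]-[r+s]≡[p-r]+[q-s] = solve 4 (λ p q r s → (p :+ q) :- (r :+ s) := (p :- r) :+ (q :- s)) refl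

∣p-q∣≡∣q-p∣ : ∀ p q → ∣ p - q ∣ ≡ ∣ q - p ∣
∣p-q∣≡∣q-p∣ p q = trans (cong ∣_∣ (p-q≡-[q-p] p q)) (ℚP.∣-p∣≡∣p∣ (q - p))

∣p-r∣≤∣p-q∣+∣q-r∣ : ∀ p q r → ∣ p - r ∣ ≤ℚ ∣ p - q ∣ + ∣ q - r ∣
∣p-r∣≤∣p-q∣+∣q-r∣ p q r =
  subst (λ x → ∣ x ∣ ≤ℚ ∣ p - q ∣ + ∣ q - r ∣) (sym (telescope p q r))
    (ℚP.∣p+q∣≤∣p∣+∣q∣ (p - q) (q - r))
  where
  telescope : ∀ p q r → p - r ≡ (p - q) + (q - r)
  telescope = solve 3 (λ p q r → p :- r := (p :- q) :+ (q :- r)) refl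

∣[p+q]-[r+s]∣≤∣p-r∣+∣q-s∣ : ∀ p q r s → ∣ (p + q) - (r + s) ∣ ≤ℚ ∣ p - r ∣ + ∣ q - s ∣
∣[p+q]-[r+s]∣≤∣p-r∣+∣q-s∣ p q r s =
  subst (λ x → ∣ x ∣ ≤ℚ ∣ p - r ∣ + ∣ q - s ∣) (sym ([p+q]-[r+s]≡[p-r]+[q-s] p q r s))
    (ℚP.∣p+q∣≤∣p∣+∣q∣ (p - r) (q - s))

c≤p≤c+e∧c≤q≤c+e⇒∣p-q∣≤e : ∀ {p q c e} → c ≤ℚ p → p ≤ℚ c + e → c ≤ℚ q → q ≤ℚ c + e →
                          ∣ p - q ∣ ≤ℚ e
c≤p≤c+e∧c≤q≤c+e⇒∣p-q∣≤e {p} {q} {c} {e} c≤p p≤c+e c≤q q≤c+e =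
  p≤q∧-p≤q⇒∣p∣≤q (x-y≤e p≤c+e c≤q) (subst (_≤ℚ e) (p-q≡-[q-p] q p) (x-y≤e q≤c+e c≤p))
  where
  cancel : (c + e) - c ≡ e
  cancel = solve 2 (λ c e → (c :+ e) :- c := e) refl c e
  x-y≤e : ∀ {x y} → x ≤ℚ c + e → c ≤ℚ y → x - y ≤ℚ e
  x-y≤e x≤c+e c≤y =
    ℚP.≤-trans (ℚP.+-mono-≤ x≤c+e (ℚP.neg-antimono-≤ c≤y)) (ℚP.≤-reflexive cancel)

BoundedDiffSeq : ℕ → ℚ → (ℕ → ℚ) → Set
BoundedDiffSeq N δ f = ∀ t → suc t < N → ∣ f t - f (suc t) ∣ <ℚ δ

∣f[j]-f[j+d]∣≤dδ : ∀ {N δ} f → BoundedDiffSeq N δ f →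
                   ∀ j d → j ℕ.+ d < N → ∣ f j - f (j ℕ.+ d) ∣ ≤ℚ toℚ d * δ
∣f[j]-f[j+d]∣≤dδ {δ = δ} f bd j zero _ rewrite ℕP.+-identityʳ j | ℚP.+-inverseʳ (f j) =
  ℚP.≤-reflexive (sym (ℚP.*-zeroˡ δ))
∣f[j]-f[j+d]∣≤dδ {δ = δ} f bd j (suc d) j+d<N rewrite ℕP.+-suc j d = ℚP.≤-trans
  (∣p-r∣≤∣p-q∣+∣q-r∣ (f j) (f (j ℕ.+ d)) (f (suc (j ℕ.+ d))))
  (ℚP.≤-trans
    (ℚP.+-mono-≤ (∣f[j]-f[j+d]∣≤dδ f bd j d (ℕP.<⇒≤ j+d<N)) (ℚP.<⇒≤ (bd (j ℕ.+ d) j+d<N)))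
    (ℚP.≤-reflexive (trans (one-more-step (toℚ d) δ) (cong (_* δ) (sym (toℚ-suc d))))))
  where
  one-more-step : ∀ t δ → t * δ + δ ≡ (1ℚ + t) * δ
  one-more-step = solve 2 (λ t δ → t :* δ :+ δ := (con 1ℚ :+ t) :* δ) refl

module _ (m : ℕ) .{{_ : NonZero m}} where

  i≡blk[i]+i%m : ∀ i → i ≡ blk m i ℕ.+ i % m
  i≡blk[i]+i%m i = trans (m≡m%n+[m/n]*n i m) (ℕP.+-comm (i % m) (blk m i))

  blk[i]<n : ∀ {i n} → i < n → blk m i < n
  blk[i]<n {i} = ℕP.≤-<-trans (m/n*n≤m i m)

  ∣f[blk[i]]-f[i]∣≤mδ : ∀ {N δ} f → 0ℚ ≤ℚ δ → BoundedDiffSeq N δ f →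
                        ∀ {i} → i < N → ∣ f (blk m i) - f i ∣ ≤ℚ toℚ m * δ
  ∣f[blk[i]]-f[i]∣≤mδ {N} {δ} f 0≤δ bd {i} i<N =
    subst (λ x → ∣ f (blk m i) - f x ∣ ≤ℚ toℚ m * δ) (sym (i≡blk[i]+i%m i))
      (ℚP.≤-trans (∣f[j]-f[j+d]∣≤dδ f bd (blk m i) (i % m) (subst (_< N) (i≡blk[i]+i%m i) i<N))
        (ℚP.*-monoʳ-≤-nonNeg δ {{nonNegative 0≤δ}} (toℚ-mono-≤ (ℕP.<⇒≤ (m%n<n i m)))))

row-boundedDiffSeq : ∀ {n δ} X {a} → BoundedDiff n δ X → a < n → BoundedDiffSeq n δ (X a)
row-boundedDiffSeq X bd a<n t = proj₁ bd _ t a<n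

col-boundedDiffSeq : ∀ {n δ} X {b} → BoundedDiff n δ X → b < n → BoundedDiffSeq n δ (λ a → X a b)
col-boundedDiffSeq X bd b<n t t+1<n = proj₂ bd t _ t+1<n b<n

∣X[i′][k′]-X[i][k]∣≤2mδ : ∀ m .{{_ : NonZero m}} {n δ} X → 0ℚ ≤ℚ δ → BoundedDiff n δ X →
                         ∀ {i k} → i < n → k < n →
                         ∣ X (blk m i) (blk m k) - X i k ∣ ≤ℚ toℚ m * δ + toℚ m * δ
∣X[i′][k′]-X[i][k]∣≤2mδ m X 0≤δ bd {i} {k} i<n k<n = ℚP.≤-trans
  (∣p-r∣≤∣p-q∣+∣q-r∣ (X (blk m i) (blk m k)) (X (blk m i) k) (X i k))
  (ℚP.+-mono-≤
    (∣f[blk[i]]-f[i]∣≤mδ m (X (blk m i)) 0≤δ (row-boundedDiffSeq X bd (blk[i]<n m i<n)) k<n)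
    (∣f[blk[i]]-f[i]∣≤mδ m (λ a → X a k) 0≤δ (col-boundedDiffSeq X bd k<n) i<n))

foldr-⊓-map-≤ : ∀ (f : ℕ → ℚ) z {xs k} → k ∈ xs → foldr _⊓_ z (map f xs) ≤ℚ f k
foldr-⊓-map-≤ f z (here refl) = ℚP.p⊓q≤p _ _
foldr-⊓-map-≤ f z {x ∷ _} (there k∈xs) = ℚP.≤-trans (ℚP.p⊓q≤q (f x) _) (foldr-⊓-map-≤ f z k∈xs)

Ctilde≤ : ∀ {m n} A B i j {k} → InBlocks m n k → Ctilde m n A B i j ≤ℚ A i k + B k j
Ctilde≤ {m} A B i j (k<n , m∣k) = foldr-⊓-map-≤ _ _ (∈-filter⁺ (m ∣?_) (∈-upTo⁺ k<n) m∣k)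

InK∧InK⇒∣diff∣≤8δm : ∀ {m n} δ A B i j {k r} → InK m n δ A B i j k → InK m n δ A B i j r →
                     ∣ (A i k + B k j) - (A i r + B r j) ∣ ≤ℚ toℚ 8 * δ * toℚ m
InK∧InK⇒∣diff∣≤8δm δ A B i j (k∈[n]′ , k-near) (r∈[n]′ , r-near) =
  c≤p≤c+e∧c≤q≤c+e⇒∣p-q∣≤e (Ctilde≤ A B i j k∈[n]′) k-near (Ctilde≤ A B i j r∈[n]′) r-near

4mδ+[8δm+2mδ]≡14δm : ∀ m δ →
  m * δ + m * δ + (m * δ + m * δ) + (toℚ 8 * δ * m + (m * δ + m * δ)) ≡ toℚ 14 * δ * m
4mδ+[8δm+2mδ]≡14δm = solve 2 (λ m δ →
  m :* δ :+ m :* δ :+ (m :* δ :+ m :* δ) :+ (con (toℚ 8) :* δ :* m :+ (m :* δ :+ m :* δ))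
  := con (toℚ 14) :* δ :* m) refl

corollary2 : (n m p q : ℕ) → .{{_ : NonZero m}} →
    n ≡ 2 ^ p → m ≡ 2 ^ q →
    ((0 < q × q < p) ⊎ (p ≡ 0 × q ≡ 0)) →
    (δ : ℚ) → 0ℚ <ℚ δ →
    (A B : Matrix) → BoundedDiff n δ A → BoundedDiff n δ B →
    (R : ℕ → Set) → (∀ r → R r → InBlocks m n r) →
    ∀ i j k r → i < n → j < n → k < n → r < n →
    InK m n δ A B (blk m i) (blk m j) (blk m k) →
    R r → InK m n δ A B (blk m i) (blk m j) r →
    ∣ Ar A r i k + Br B r k j ∣ ≤ℚ toℚ 16 * δ * toℚ m
corollary2 _ m _ _ _ _ _ δ 0<δ A B bdA bdB _ _ i j k r i<n j<n k<n r<n k′∈K _ r∈K = begin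
  ∣ Ar A r i k + Br B r k j ∣
    ≡⟨ cong ∣_∣ (sym ([p+q]-[r+s]≡[p-r]+[q-s] (A i k) (B k j) (A i r) (B r j))) ⟩
  ∣ S - T ∣                            ≤⟨ ∣p-r∣≤∣p-q∣+∣q-r∣ S P T ⟩
  ∣ S - P ∣ + ∣ P - T ∣                ≤⟨ ℚP.+-mono-≤ (ℚP.≤-reflexive (∣p-q∣≡∣q-p∣ S P))
                                                      (∣p-r∣≤∣p-q∣+∣q-r∣ P Q T) ⟩
  ∣ P - S ∣ + (∣ P - Q ∣ + ∣ Q - T ∣)  ≤⟨ ℚP.+-mono-≤ ∣P-S∣≤4mδ (ℚP.+-mono-≤ ∣P-Q∣≤8δm ∣Q-T∣≤2mδ) ⟩
  W + W + (W + W) + (toℚ 8 * δ * toℚ m + (W + W))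
                                       ≡⟨ 4mδ+[8δm+2mδ]≡14δm (toℚ m) δ ⟩
  toℚ 14 * δ * toℚ m                   ≤⟨ ℚP.*-monoʳ-≤-nonNeg (toℚ m) {{ℚP.normalize-nonNeg m 1}}
                                           (ℚP.*-monoʳ-≤-nonNeg δ {{nonNegative 0≤δ}}
                                             (toℚ-mono-≤ (ℕP.m≤m+n 14 2))) ⟩
  toℚ 16 * δ * toℚ m                   ∎
  where
  open ℚP.≤-Reasoning
  0≤δ = ℚP.<⇒≤ 0<δ
  i′ = blk m i
  j′ = blk m j
  k′ = blk m k
  S = A i k + B k j
  T = A i r + B r j
  P = A i′ k′ + B k′ j′
  Q = A i′ r + B r j′
  W = toℚ m * δ
  ∣P-S∣≤4mδ : ∣ P - S ∣ ≤ℚ W + W + (W + W)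
  ∣P-S∣≤4mδ = ℚP.≤-trans (∣[p+q]-[r+s]∣≤∣p-r∣+∣q-s∣ (A i′ k′) (B k′ j′) (A i k) (B k j))
    (ℚP.+-mono-≤ (∣X[i′][k′]-X[i][k]∣≤2mδ m A 0≤δ bdA i<n k<n)
                 (∣X[i′][k′]-X[i][k]∣≤2mδ m B 0≤δ bdB k<n j<n))
  ∣P-Q∣≤8δm : ∣ P - Q ∣ ≤ℚ toℚ 8 * δ * toℚ m
  ∣P-Q∣≤8δm = InK∧InK⇒∣diff∣≤8δm δ A B i′ j′ k′∈K r∈K
  ∣Q-T∣≤2mδ : ∣ Q - T ∣ ≤ℚ W + W
  ∣Q-T∣≤2mδ = ℚP.≤-trans (∣[p+q]-[r+s]∣≤∣p-r∣+∣q-s∣ (A i′ r) (B r j′) (A i r) (B r j))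
    (ℚP.+-mono-≤ (∣f[blk[i]]-f[i]∣≤mδ m (λ a → A a r) 0≤δ (col-boundedDiffSeq A bdA r<n) i<n)
                 (∣f[blk[i]]-f[i]∣≤mδ m (B r) 0≤δ (row-boundedDiffSeq B bdB r<n) j<n))
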